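{- Let $CS$ be a constant specification. (1) Let $p_1,\dots,p_n\in JVar$, let $X_1,\dots,X_n$ be finite sets of individual variables and $X=\bigcup_{i=1}^nX_i$. If $p_1{:}_{X_1}\Phi_1,\dots,p_n{:}_{X_n}\Phi_n\vdash_{CS}\Phi$, then there exist a justification term $t(p_1,\dots,p_n)$ and a constant specification $CS'\supseteq CS$ such that $p_1{:}_{X_1}\Phi_1,\dots,p_n{:}_{X_n}\Phi_n\vdash_{CS'} t(p_1,\dots,p_n){:}_X\Phi$. (2) If $\Phi_1,\dots,\Phi_n\vdash_{CS}\Phi$, then there are a justification term $t(p_1,\dots,p_n)$ and a constant specification $CS'\supseteq CS$ such that $p_1{:}_{X_1}\Phi_1,\dots,p_n{:}_{X_n}\Phi_n\vdash_{CS'}t(p_1,\dots,p_n){:}_X\Phi$ for $X=\bigcup_{i=1}^nX_i$. (3) If $\vdash_{CS}\Phi$, then $\vdash_{CS'}t{:}_\varnothing\Phi$ for some justification term $t$ and some constant specification $CS'\supseteq CS$.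
   Context: Language. Fix countably infinite sets $Var$ (individual variables), $JVar$ (justification variables), $JConst$ (justification constants), and infinitely many predicate symbols of each arity. Justification terms: $t ::= p \mid c \mid (t\cdot t)\mid (t+t)\mid\ !t \mid gen_x(t)$ with $p\in JVar$, $c\in JConst$, $x\in Var$. A term $t(p_1,\dots,p_n)$ is one whose justification variables are among $p_1,\dots,p_n$. Formulas: $P(x_1,\dots,x_n)$; $\neg\Phi$, $\Phi\wedge\Psi$, $\Phi\vee\Psi$, $\Phi\to\Psi$, $\Phi\leftrightarrow\Psi$, $\forall x\Phi$, $\exists x\Phi$; and, for every finite $X\subseteq Var$ and term $t$, $\Box_X\Phi$ and $t{:}_X\Phi$. Free/bound occurrences are as usual for first-order constructs; in $\Box_X\Phi$ and $t{:}_X\Phi$ a free occurrence of $x$ in $\Phi$ stays free iff $x\in X$ (otherwise it becomes bound), bound ones stay bound, and the variables in $X$ are free; so $FV(\Box_X\Phi)=FV(t{:}_X\Phi)=X$. Logic. $\mathit{FOLP}^\Box_0$ has axioms: (A0) classical first-order axioms; for $y\notin FV(\Phi)$: (A1) $t{:}_{X\cup\{y\}}\Phi\to t{:}_X\Phi$, (A1$'$) $\Box_{X\cup\{y\}}\Phi\to\Box_X\Phi$; (A2) $t{:}_X\Phi\to t{:}_{X\cup\{y\}}\Phi$, (A2$'$) $\Box_X\Phi\to\Box_{X\cup\{y\}}\Phi$; (A3) $t{:}_X\Phi\to\Phi$, (A3$'$) $\Box_X\Phi\to\Phi$; (A4) $t{:}_X(\Phi\to\Psi)\to(s{:}_X\Phi\to[t\cdot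 s]{:}_X\Psi)$, (A4$'$) $\Box_X(\Phi\to\Psi)\to(\Box_X\Phi\to\Box_X\Psi)$; (A5) $t{:}_X\Phi\to[t+s]{:}_X\Phi$, $s{:}_X\Phi\to[t+s]{:}_X\Phi$; (A6) $t{:}_X\Phi\to\ !t{:}_Xt{:}_X\Phi$, (A6$'$) $\Box_X\Phi\to\Box_X\Box_X\Phi$; for $x\notin X$: (A7) $t{:}_X\Phi\to gen_x(t){:}_X\forall x\Phi$, (A7$'$) $\Box_X\Phi\to\Box_X\forall x\Phi$; (A8) $t{:}_X\Phi\to\Box_X\Phi$. Rules: modus ponens, generalization ($\vdash\Phi\Rightarrow\vdash\forall x\Phi$), necessitation ($\vdash\Phi\Rightarrow\vdash\Box_\varnothing\Phi$). A constant specification $CS$ is a set of formulas $c{:}_\varnothing\Phi$ with $c\in JConst$ and $\Phi$ an axiom of $\mathit{FOLP}^\Box_0$; $\mathit{FOLP}^\Box_{CS}$ adds the members of $CS$ as axioms. $\Gamma\vdash_{CS}\Phi$ means $\Phi$ is derivable in $\mathit{FOLP}^\Box_{CS}$ from hypotheses $\Gamma$, where generalization is applied only to variables not free in formulas of $\Gamma$ and necessitation is applied only to axioms of $\mathit{FOLP}^\Box_0$; $\vdash_{CS}\Phi$ means derivability with no hypotheses. -}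

module Defs where

open import Data.Nat using (ℕ; _<_; _≟_)
open import Data.Bool using (Bool; true; false; not; _∧_; _∨_; if_then_else_)
open import Data.List using (List; []; _∷_; _++_)
open import Data.List.Relation.Unary.Linked using (Linked; [])
open import Data.List.Relation.Unary.All using (All)
open import Data.List.Membership.Propositional using (_∈_; _∉_)
open import Data.Vec as Vec using (Vec)
open import Data.Fin using (Fin)
open import Data.Product using (Σ; ∃; _×_)
open import Data.Sum using (_⊎_)
open import Relation.Binary.PropositionalEquality using (_≡_; _≢_)
open import Relation.Nullary using (¬_; does)

Var : Set
Var = ℕ

JVar : Set
JVar = ℕ

JConst : Set
JConst = ℕ

-- A predicate symbol is a pair (name, arity); infinitely many of each arity.
PredName : Set
PredName = ℕ

-- Finite sets of individual variables, in canonical form: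
-- strictly increasing lists (proof irrelevant), so that two finite sets
-- with the same elements are equal as syntax.

record FinSet : Set where
  constructor mkSet
  field
    elems   : List Var
    .sorted : Linked _<_ elems

open FinSet public

∅ : FinSet
∅ = mkSet [] []

_∈ˢ_ : Var → FinSet → Set
x ∈ˢ X = x ∈ elems X

_∉ˢ_ : Var → FinSet → Set
x ∉ˢ X = ¬ (x ∈ˢ X)

IsInsert : Var → FinSet → FinSet → Set
IsInsert y X Y = ∀ z → (z ∈ˢ Y → (z ∈ˢ X ⊎ z ≡ y)) × ((z ∈ˢ X ⊎ z ≡ y) → z ∈ˢ Y)

IsReplace : Var → Var → FinSet → FinSet → Set
IsReplace x y X Y =
  ∀ z → (z ∈ˢ Y → ((z ∈ˢ X × z ≢ x) ⊎ z ≡ y)) × (((z ∈ˢ X × z ≢ x) ⊎ z ≡ y) → z ∈ˢ Y)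

IsUnion : {n : ℕ} → (Fin n → FinSet) → FinSet → Set
IsUnion {n} Xs X = ∀ z → (z ∈ˢ X → ∃ λ i → z ∈ˢ Xs i) × ((∃ λ i → z ∈ˢ Xs i) → z ∈ˢ X)

infixl 7 _·_
infixl 6 _⊕_
data JTerm : Set where
  jv   : JVar → JTerm
  jc   : JConst → JTerm
  _·_  : JTerm → JTerm → JTerm
  _⊕_  : JTerm → JTerm → JTerm
  !_   : JTerm → JTerm
  gen  : Var → JTerm → JTerm

jvars : JTerm → List JVar
jvars (jv p)    = p ∷ []
jvars (jc c)    = []
jvars (t · s)   = jvars t ++ jvars s
jvars (t ⊕ s)   = jvars t ++ jvars s
jvars (! t)     = jvars t
jvars (gen x t) = jvars t

infixr 4 _⇒_ _⇔'_
infixr 5 _∨'_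
infixr 6 _∧'_
data Formula : Set where
  pred   : PredName → (k : ℕ) → Vec Var k → Formula
  ¬'_    : Formula → Formula
  _∧'_   : Formula → Formula → Formula
  _∨'_   : Formula → Formula → Formula
  _⇒_    : Formula → Formula → Formula
  _⇔'_   : Formula → Formula → Formula
  ∀'     : Var → Formula → Formula
  ∃'     : Var → Formula → Formula
  □[_]_  : FinSet → Formula → Formula
  _∶[_]_ : JTerm → FinSet → Formula → Formula

remove : Var → List Var → List Var
remove x []       = []
remove x (y ∷ ys) = if does (x ≟ y) then remove x ys else y ∷ remove x ys

fv : Formula → List Var
fv (pred P k xs) = Vec.toList xs
fv (¬' Φ)        = fv Φ
fv (Φ ∧' Ψ)      = fv Φ ++ fv Ψ
fv (Φ ∨' Ψ)      = fv Φ ++ fv Ψ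
fv (Φ ⇒ Ψ)       = fv Φ ++ fv Ψ
fv (Φ ⇔' Ψ)      = fv Φ ++ fv Ψ
fv (∀' x Φ)      = remove x (fv Φ)
fv (∃' x Φ)      = remove x (fv Φ)
fv (□[ X ] Φ)    = elems X
fv (t ∶[ X ] Φ)  = elems X

-- Propositional tautologies (prime formulas: atoms, quantified, modal,
-- justification formulas)

eval : (Formula → Bool) → Formula → Bool
eval v (¬' Φ)   = not (eval v Φ)
eval v (Φ ∧' Ψ) = eval v Φ ∧ eval v Ψ
eval v (Φ ∨' Ψ) = eval v Φ ∨ eval v Ψ
eval v (Φ ⇒ Ψ)  = not (eval v Φ) ∨ eval v Ψ
eval v (Φ ⇔' Ψ) = (eval v Φ ∧ eval v Ψ) ∨ (not (eval v Φ) ∧ not (eval v Ψ))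
eval v Φ        = v Φ

Tautology : Formula → Set
Tautology Φ = ∀ (v : Formula → Bool) → eval v Φ ≡ true

-- Substitution of the variable y for free occurrences of x:
-- Sub x y Φ Φ' holds iff y is free for x in Φ and Φ' = Φ[y/x].

rename : Var → Var → Var → Var
rename x y z = if does (z ≟ x) then y else z

data Sub (x y : Var) : Formula → Formula → Set where
  s-pred : ∀ {P k} (xs : Vec Var k) → Sub x y (pred P k xs) (pred P k (Vec.map (rename x y) xs))
  s-¬    : ∀ {Φ Φ'} → Sub x y Φ Φ' → Sub x y (¬' Φ) (¬' Φ')
  s-∧    : ∀ {Φ Φ' Ψ Ψ'} → Sub x y Φ Φ' → Sub x y Ψ Ψ' → Sub x y (Φ ∧' Ψ) (Φ' ∧' Ψ')
  s-∨    : ∀ {Φ Φ' Ψ Ψ'} → Sub x y Φ Φ' → Sub x y Ψ Ψ' → Sub x y (Φ ∨' Ψ) (Φ' ∨' Ψ')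
  s-⇒    : ∀ {Φ Φ' Ψ Ψ'} → Sub x y Φ Φ' → Sub x y Ψ Ψ' → Sub x y (Φ ⇒ Ψ) (Φ' ⇒ Ψ')
  s-⇔    : ∀ {Φ Φ' Ψ Ψ'} → Sub x y Φ Φ' → Sub x y Ψ Ψ' → Sub x y (Φ ⇔' Ψ) (Φ' ⇔' Ψ')
  s-∀-nofree : ∀ {z Φ} → x ∉ fv (∀' z Φ) → Sub x y (∀' z Φ) (∀' z Φ)
  s-∀        : ∀ {z Φ Φ'} → z ≢ x → z ≢ y → Sub x y Φ Φ' → Sub x y (∀' z Φ) (∀' z Φ')
  s-∃-nofree : ∀ {z Φ} → x ∉ fv (∃' z Φ) → Sub x y (∃' z Φ) (∃' z Φ)
  s-∃        : ∀ {z Φ Φ'} → z ≢ x → z ≢ y → Sub x y Φ Φ' → Sub x y (∃' z Φ) (∃' z Φ')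
  -- □_X Φ and t :_X Φ : free variables are exactly X; those of Φ outside X are bound
  s-□-nofree : ∀ {X Φ} → x ∉ˢ X → Sub x y (□[ X ] Φ) (□[ X ] Φ)
  s-□        : ∀ {X X' Φ Φ'} → x ∈ˢ X → (y ∈ˢ X ⊎ y ∉ fv Φ) → IsReplace x y X X' →
               Sub x y Φ Φ' → Sub x y (□[ X ] Φ) (□[ X' ] Φ')
  s-j-nofree : ∀ {t X Φ} → x ∉ˢ X → Sub x y (t ∶[ X ] Φ) (t ∶[ X ] Φ)
  s-j        : ∀ {t X X' Φ Φ'} → x ∈ˢ X → (y ∈ˢ X ⊎ y ∉ fv Φ) → IsReplace x y X X' →
               Sub x y Φ Φ' → Sub x y (t ∶[ X ] Φ) (t ∶[ X' ] Φ')

data Axiom : Formula → Set where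
  taut : ∀ {Φ} → Tautology Φ → Axiom Φ
  q∀   : ∀ {x y Φ Φ'} → Sub x y Φ Φ' → Axiom (∀' x Φ ⇒ Φ')
  q∃   : ∀ {x y Φ Φ'} → Sub x y Φ Φ' → Axiom (Φ' ⇒ ∃' x Φ)
  q∀⇒  : ∀ {x Φ Ψ} → x ∉ fv Ψ → Axiom (∀' x (Ψ ⇒ Φ) ⇒ (Ψ ⇒ ∀' x Φ))
  q∃⇒  : ∀ {x Φ Ψ} → x ∉ fv Ψ → Axiom (∀' x (Φ ⇒ Ψ) ⇒ (∃' x Φ ⇒ Ψ))
  a1   : ∀ {t X Y y Φ} → y ∉ fv Φ → IsInsert y X Y → Axiom (t ∶[ Y ] Φ ⇒ t ∶[ X ] Φ)
  a1'  : ∀ {X Y y Φ} → y ∉ fv Φ → IsInsert y X Y → Axiom (□[ Y ] Φ ⇒ □[ X ] Φ)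
  a2   : ∀ {t X Y y Φ} → IsInsert y X Y → Axiom (t ∶[ X ] Φ ⇒ t ∶[ Y ] Φ)
  a2'  : ∀ {X Y y Φ} → IsInsert y X Y → Axiom (□[ X ] Φ ⇒ □[ Y ] Φ)
  a3   : ∀ {t X Φ} → Axiom (t ∶[ X ] Φ ⇒ Φ)
  a3'  : ∀ {X Φ} → Axiom (□[ X ] Φ ⇒ Φ)
  a4   : ∀ {t s X Φ Ψ} → Axiom (t ∶[ X ] (Φ ⇒ Ψ) ⇒ (s ∶[ X ] Φ ⇒ (t · s) ∶[ X ] Ψ))
  a4'  : ∀ {X Φ Ψ} → Axiom (□[ X ] (Φ ⇒ Ψ) ⇒ (□[ X ] Φ ⇒ □[ X ] Ψ))
  a5l  : ∀ {t s X Φ} → Axiom (t ∶[ X ] Φ ⇒ (t ⊕ s) ∶[ X ] Φ)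
  a5r  : ∀ {t s X Φ} → Axiom (s ∶[ X ] Φ ⇒ (t ⊕ s) ∶[ X ] Φ)
  a6   : ∀ {t X Φ} → Axiom (t ∶[ X ] Φ ⇒ (! t) ∶[ X ] (t ∶[ X ] Φ))
  a6'  : ∀ {X Φ} → Axiom (□[ X ] Φ ⇒ □[ X ] (□[ X ] Φ))
  a7   : ∀ {t X x Φ} → x ∉ˢ X → Axiom (t ∶[ X ] Φ ⇒ gen x t ∶[ X ] ∀' x Φ)
  a7'  : ∀ {X x Φ} → x ∉ˢ X → Axiom (□[ X ] Φ ⇒ □[ X ] ∀' x Φ)
  a8   : ∀ {t X Φ} → Axiom (t ∶[ X ] Φ ⇒ □[ X ] Φ)

-- Constant specifications: sets of formulas c :_∅ Φ with Φ an axiom.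
-- member c Φ  means  (c :_∅ Φ) ∈ CS.

record ConstSpec : Set₁ where
  field
    member    : JConst → Formula → Set
    axiomatic : ∀ {c Φ} → member c Φ → Axiom Φ

open ConstSpec public

_⊆CS_ : ConstSpec → ConstSpec → Set
CS ⊆CS CS' = ∀ {c Φ} → member CS c Φ → member CS' c Φ

data Deriv (CS : ConstSpec) (Γ : List Formula) : Formula → Set where
  ax   : ∀ {Φ} → Axiom Φ → Deriv CS Γ Φ
  cs   : ∀ {c Φ} → member CS c Φ → Deriv CS Γ (jc c ∶[ ∅ ] Φ)
  hyp  : ∀ {Φ} → Φ ∈ Γ → Deriv CS Γ Φ
  mp   : ∀ {Φ Ψ} → Deriv CS Γ (Φ ⇒ Ψ) → Deriv CS Γ Φ → Deriv CS Γ Ψ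
  generalize : ∀ {x Φ} → All (λ ψ → x ∉ fv ψ) Γ → Deriv CS Γ Φ → Deriv CS Γ (∀' x Φ)
  nec  : ∀ {Φ} → Axiom Φ → Deriv CS Γ (□[ ∅ ] Φ)

syntax Deriv CS Γ Φ = Γ ⊢[ CS ] Φ

TermOver : {n : ℕ} → (Fin n → JVar) → JTerm → Set
TermOver p t = All (λ q → ∃ λ i → p i ≡ q) (jvars t)

{-# OPTIONS --safe #-}
-- Induction on the derivation, producing a justification t ∶[ Y ] Φ for every admissible
-- index set Y: axioms and necessitation are justified by constants (with A6 and A8), modus
-- ponens by application (A4), generalization by gen (A7), the hypotheses by p_i or ! p_i,
-- and index sets are adjusted by A1 and A2. Y is admissible when it contains the variables
-- of each X_i that are free in the i-th hypothesis; a generalization over x, which is free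
-- in no hypothesis, is lifted at Y ∖ {x}, which stays admissible and lets A7 apply.
module Submission where

open import Defs
open import Function using (id; _∘_)
open import Data.Nat using (ℕ; _<_; _≟_)
open import Data.Nat.Properties using (<-cmp; <-trans)
open import Data.Fin using (Fin)
open import Data.List using (List; []; _∷_; tabulate; filter)
import Data.List as List
open import Data.Maybe.Relation.Binary.Connected using (Connected; just)
import Data.Maybe as Maybe
open import Data.Product using (Σ; _×_; _,_; proj₁; proj₂)
open import Data.Sum using (_⊎_; inj₁; inj₂)
import Data.Sum as Sum
open import Data.List.Relation.Unary.Linked using (Linked; [-]; _∷_; _∷′_; head′; tail)
open import Data.List.Relation.Unary.Linked.Properties using (filter⁺)
open import Data.List.Relation.Unary.All as All using (All; []; _∷_)
open import Data.List.Relation.Unary.All.Properties using (++⁺; tabulate⁻)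
open import Data.List.Relation.Unary.Any using (here; there)
open import Data.List.Membership.Propositional using (_∈_; _∉_)
open import Data.List.Membership.Propositional.Properties using (∈-tabulate⁺; ∈-tabulate⁻; ∈-filter⁺; ∈-filter⁻)
open import Data.List.Membership.DecPropositional _≟_ using (_∈?_)
open import Relation.Binary.PropositionalEquality using (_≡_; _≢_; refl)
open import Relation.Binary.Definitions using (tri<; tri≈; tri>)
open import Relation.Nullary using (yes; no; ¬?)
open import Relation.Unary using (Decidable)

insertList : Var → List Var → List Var
insertList y []       = y ∷ []
insertList y (x ∷ xs) with <-cmp y x
... | tri< _ _ _ = y ∷ x ∷ xs
... | tri≈ _ _ _ = x ∷ xs
... | tri> _ _ _ = x ∷ insertList y xs

∈-insertList⁻ : ∀ {z} y xs → z ∈ insertList y xs → z ∈ xs ⊎ z ≡ y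
∈-insertList⁻ y []       (here z≡y) = inj₂ z≡y
∈-insertList⁻ y (x ∷ xs) z∈ with <-cmp y x | z∈
... | tri< _ _ _ | here z≡y   = inj₂ z≡y
... | tri< _ _ _ | there z∈xs = inj₁ z∈xs
... | tri≈ _ _ _ | z∈xs       = inj₁ z∈xs
... | tri> _ _ _ | here z≡x   = inj₁ (here z≡x)
... | tri> _ _ _ | there z∈   = Sum.map₁ there (∈-insertList⁻ y xs z∈)

∈-insertList⁺ : ∀ {z} y xs → z ∈ xs ⊎ z ≡ y → z ∈ insertList y xs
∈-insertList⁺ y []       (inj₂ z≡y) = here z≡y
∈-insertList⁺ y (x ∷ xs) z∈ with <-cmp y x | z∈
... | tri< _ _ _    | inj₁ z∈xs         = there z∈xs
... | tri< _ _ _    | inj₂ z≡y          = here z≡y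
... | tri≈ _ _ _    | inj₁ z∈xs         = z∈xs
... | tri≈ _ refl _ | inj₂ z≡y         = here z≡y
... | tri> _ _ _    | inj₁ (here z≡x)   = here z≡x
... | tri> _ _ _    | inj₁ (there z∈xs) = there (∈-insertList⁺ y xs (inj₁ z∈xs))
... | tri> _ _ _    | inj₂ z≡y          = there (∈-insertList⁺ y xs (inj₂ z≡y))

insertList-head : ∀ {x} y xs → x < y → Connected _<_ (Maybe.just x) (List.head xs) →
                  Connected _<_ (Maybe.just x) (List.head (insertList y xs))
insertList-head y []       x<y _ = just x<y
insertList-head y (z ∷ zs) x<y x<z with <-cmp y z
... | tri< _ _ _ = just x<y
... | tri≈ _ _ _ = x<z
... | tri> _ _ _ = x<z

insertList-sorted : ∀ y xs → Linked _<_ xs → Linked _<_ (insertList y xs)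
insertList-sorted y []       _ = [-]
insertList-sorted y (x ∷ xs) l with <-cmp y x
... | tri< y<x _ _ = y<x ∷ l
... | tri≈ _ _ _   = l
... | tri> _ _ x<y = insertList-head y xs x<y (head′ l) ∷′ insertList-sorted y xs (tail l)

insert : Var → FinSet → FinSet
insert y (mkSet xs sorted) = mkSet (insertList y xs) (insertList-sorted y xs sorted)

insert-isInsert : ∀ y X → IsInsert y X (insert y X)
insert-isInsert y X z = ∈-insertList⁻ y (elems X) , ∈-insertList⁺ y (elems X)

insertAll : List Var → FinSet → FinSet
insertAll []      Z = Z
insertAll (y ∷ l) Z = insert y (insertAll l Z)

∈-insertAll⁻ : ∀ {z} l Z → z ∈ˢ insertAll l Z → z ∈ˢ Z ⊎ z ∈ l
∈-insertAll⁻ []      Z z∈ = inj₁ z∈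
∈-insertAll⁻ (y ∷ l) Z z∈ with proj₁ (insert-isInsert y (insertAll l Z) _) z∈
... | inj₂ z≡y = inj₂ (here z≡y)
... | inj₁ z∈′ = Sum.map₂ there (∈-insertAll⁻ l Z z∈′)

∈-insertAll⁺ : ∀ {z} l Z → z ∈ˢ Z ⊎ z ∈ l → z ∈ˢ insertAll l Z
∈-insertAll⁺ []      Z (inj₁ z∈Z) = z∈Z
∈-insertAll⁺ (y ∷ l) Z z∈ = proj₂ (insert-isInsert y (insertAll l Z) _) (step z∈)
  where
  step : ∀ {z} → z ∈ˢ Z ⊎ z ∈ y ∷ l → z ∈ˢ insertAll l Z ⊎ z ≡ y
  step (inj₁ z∈Z)         = inj₁ (∈-insertAll⁺ l Z (inj₁ z∈Z))
  step (inj₂ (here z≡y))  = inj₂ z≡y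
  step (inj₂ (there z∈l)) = inj₁ (∈-insertAll⁺ l Z (inj₂ z∈l))

delete : Var → FinSet → FinSet
delete x (mkSet xs sorted) = mkSet (filter (¬? ∘ (_≟ x)) xs) (filter⁺ (¬? ∘ (_≟ x)) <-trans sorted)

∈-delete⁺ : ∀ {x z} Y → z ∈ˢ Y → z ≢ x → z ∈ˢ delete x Y
∈-delete⁺ {x} Y = ∈-filter⁺ (¬? ∘ (_≟ x))

∈-delete⁻ : ∀ {x z} Y → z ∈ˢ delete x Y → z ∈ˢ Y × z ≢ x
∈-delete⁻ {x} Y = ∈-filter⁻ (¬? ∘ (_≟ x)) {xs = elems Y}

_⊆ˢ_ : FinSet → FinSet → Set
X ⊆ˢ Y = ∀ {z} → z ∈ˢ X → z ∈ˢ Y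

-- X ⊆ Y up to variables not free in Φ, which A1 may drop from an index set.
_⊆[_]_ : FinSet → Formula → FinSet → Set
X ⊆[ Φ ] Y = ∀ {z} → z ∈ˢ X → z ∈ fv Φ → z ∈ˢ Y

IsUnion⇒⊆ : ∀ {n} {Xs : Fin n → FinSet} {X} → IsUnion Xs X → ∀ i → Xs i ⊆ˢ X
IsUnion⇒⊆ X≡⋃Xs i {z} z∈Xsi = proj₂ (X≡⋃Xs z) (i , z∈Xsi)

module _ {CS : ConstSpec} {Γ : List Formula} {t : JTerm} {Φ : Formula} where

  -- A2 with a variable already in X: this replaces X by an extensionally equal set.
  ∶-resp-≈ˢ : ∀ {X Y} → X ⊆ˢ Y → Y ⊆ˢ X → Γ ⊢[ CS ] (t ∶[ X ] Φ) → Γ ⊢[ CS ] (t ∶[ Y ] Φ)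
  ∶-resp-≈ˢ {mkSet []      _} {mkSet []      _} _   _   d = d
  ∶-resp-≈ˢ {mkSet []      _} {mkSet (y ∷ _) _} _   Y⊆X _ with Y⊆X (here refl)
  ... | ()
  ∶-resp-≈ˢ {X@(mkSet (x ∷ _) _)} {Y} X⊆Y Y⊆X d = mp (ax (a2 Y≡X∪x)) d
    where
    Y≡X∪x : IsInsert x X Y
    Y≡X∪x z = (λ z∈Y → inj₁ (Y⊆X z∈Y)) , λ { (inj₁ z∈X) → X⊆Y z∈X ; (inj₂ refl) → X⊆Y (here refl) }

  ∶-insertAll⁺ : ∀ l Z → Γ ⊢[ CS ] (t ∶[ Z ] Φ) → Γ ⊢[ CS ] (t ∶[ insertAll l Z ] Φ)
  ∶-insertAll⁺ []      Z d = d
  ∶-insertAll⁺ (y ∷ l) Z d = mp (ax (a2 (insert-isInsert y (insertAll l Z)))) (∶-insertAll⁺ l Z d)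

  ∶-insertAll⁻ : ∀ l Z → All (_∉ fv Φ) l → Γ ⊢[ CS ] (t ∶[ insertAll l Z ] Φ) → Γ ⊢[ CS ] (t ∶[ Z ] Φ)
  ∶-insertAll⁻ []      Z []           d = d
  ∶-insertAll⁻ (y ∷ l) Z (y∉Φ ∷ l∉Φ) d =
    ∶-insertAll⁻ l Z l∉Φ (mp (ax (a1 y∉Φ (insert-isInsert y (insertAll l Z)))) d)

  -- Pass through X ∪ Y: add Y by A2, then drop X ∖ Y by A1.
  ∶-move : ∀ {X Y} → X ⊆[ Φ ] Y → Γ ⊢[ CS ] (t ∶[ X ] Φ) → Γ ⊢[ CS ] (t ∶[ Y ] Φ)
  ∶-move {X} {Y} X⊆[Φ]Y d =
    ∶-insertAll⁻ X∖Y Y X∖Y∉Φ (∶-resp-≈ˢ X∪Y⊆Y∪X∖Y Y∪X∖Y⊆X∪Y (∶-insertAll⁺ (elems Y) X d))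
    where
    ∉Y? : Decidable (_∉ elems Y)
    ∉Y? = ¬? ∘ (_∈? elems Y)

    X∖Y : List Var
    X∖Y = filter ∉Y? (elems X)

    X∖Y∉Φ : All (_∉ fv Φ) X∖Y
    X∖Y∉Φ = All.tabulate λ z∈X∖Y z∈Φ →
      let z∈X , z∉Y = ∈-filter⁻ ∉Y? {xs = elems X} z∈X∖Y in z∉Y (X⊆[Φ]Y z∈X z∈Φ)

    X∪Y⊆Y∪X∖Y : insertAll (elems Y) X ⊆ˢ insertAll X∖Y Y
    X∪Y⊆Y∪X∖Y {z} z∈ with ∈-insertAll⁻ (elems Y) X z∈ | z ∈? elems Y
    ... | inj₂ z∈Y | _       = ∈-insertAll⁺ X∖Y Y (inj₁ z∈Y)
    ... | inj₁ _   | yes z∈Y = ∈-insertAll⁺ X∖Y Y (inj₁ z∈Y)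
    ... | inj₁ z∈X | no  z∉Y = ∈-insertAll⁺ X∖Y Y (inj₂ (∈-filter⁺ ∉Y? z∈X z∉Y))

    Y∪X∖Y⊆X∪Y : insertAll X∖Y Y ⊆ˢ insertAll (elems Y) X
    Y∪X∖Y⊆X∪Y z∈ with ∈-insertAll⁻ X∖Y Y z∈
    ... | inj₁ z∈Y   = ∈-insertAll⁺ (elems Y) X (inj₂ z∈Y)
    ... | inj₂ z∈X∖Y = ∈-insertAll⁺ (elems Y) X (inj₁ (proj₁ (∈-filter⁻ ∉Y? z∈X∖Y)))

  ∶-weaken : ∀ {X Y} → X ⊆ˢ Y → Γ ⊢[ CS ] (t ∶[ X ] Φ) → Γ ⊢[ CS ] (t ∶[ Y ] Φ)
  ∶-weaken X⊆Y = ∶-move (λ z∈X _ → X⊆Y z∈X)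

-- Contains every constant specification, so it serves as CS' throughout.
totalCS : ConstSpec
totalCS = record { member = λ _ → Axiom ; axiomatic = id }

Justified : ∀ {n} → (Fin n → JVar) → List Formula → FinSet → Formula → Set
Justified p Δ Y Φ = Σ JTerm λ t → TermOver p t × Δ ⊢[ totalCS ] (t ∶[ Y ] Φ)

module _ {n} {p : Fin n → JVar} {Δ : List Formula} where

  justified-weaken : ∀ {X Y Φ} → X ⊆ˢ Y → Justified p Δ X Φ → Justified p Δ Y Φ
  justified-weaken X⊆Y (t , t/p , d) = t , t/p , ∶-weaken X⊆Y d

  justified-mp : ∀ {Y Φ Ψ} → Justified p Δ Y (Φ ⇒ Ψ) → Justified p Δ Y Φ → Justified p Δ Y Ψ
  justified-mp (t , t/p , d) (s , s/p , e) = t · s , ++⁺ t/p s/p , mp (mp (ax a4) d) e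

  axiom-justified : ∀ {Y Φ} → Axiom Φ → Justified p Δ Y Φ
  axiom-justified A = justified-weaken {X = ∅} (λ ()) (jc 0 , [] , cs A)

  hyp-justified : ∀ {X Y Φ} i → jv (p i) ∶[ X ] Φ ∈ Δ → X ⊆[ Φ ] Y → Justified p Δ Y Φ
  hyp-justified i h X⊆[Φ]Y = jv (p i) , (i , refl) ∷ [] , ∶-move X⊆[Φ]Y (hyp h)

  !-hyp-justified : ∀ {X Y Φ} i → jv (p i) ∶[ X ] Φ ∈ Δ → X ⊆ˢ Y → Justified p Δ Y (jv (p i) ∶[ X ] Φ)
  !-hyp-justified i h X⊆Y = ! jv (p i) , (i , refl) ∷ [] , ∶-weaken X⊆Y (mp (ax a6) (hyp h))

  module _ {CS : ConstSpec} {Ψ : Fin n → Formula} {Xs : Fin n → FinSet}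
           (justify : ∀ i {Y} → Xs i ⊆[ Ψ i ] Y → Justified p Δ Y (Ψ i)) where

    lift : ∀ {Φ} → tabulate Ψ ⊢[ CS ] Φ → ∀ {Y} → (∀ i → Xs i ⊆[ Ψ i ] Y) → Justified p Δ Y Φ
    lift (ax A) _ = axiom-justified A
    lift (cs {c} m) _ =
      justified-weaken {X = ∅} (λ ()) (! jc c , [] , mp (ax a6) (cs (axiomatic CS m)))
    lift (hyp h) Y-covers with ∈-tabulate⁻ h
    ... | i , refl = justify i (Y-covers i)
    lift (mp d e) Y-covers = justified-mp (lift d Y-covers) (lift e Y-covers)
    lift (generalize {x} x∉Γ d) {Y} Y-covers =
      let t , t/p , D = lift d Y∖x-covers
      in  justified-weaken {X = delete x Y} Y∖x⊆Y (gen x t , t/p , mp (ax (a7 x∉Y∖x)) D)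
      where
      Y∖x-covers : ∀ i → Xs i ⊆[ Ψ i ] delete x Y
      Y∖x-covers i z∈Xsi z∈Ψi =
        ∈-delete⁺ Y (Y-covers i z∈Xsi z∈Ψi) λ { refl → tabulate⁻ x∉Γ i z∈Ψi }
      x∉Y∖x : x ∉ˢ delete x Y
      x∉Y∖x x∈ = proj₂ (∈-delete⁻ Y x∈) refl
      Y∖x⊆Y : delete x Y ⊆ˢ Y
      Y∖x⊆Y z∈ = proj₁ (∈-delete⁻ Y z∈)
    lift (nec A) _ =
      justified-mp (axiom-justified a8) (justified-weaken {X = ∅} (λ ()) (! jc 0 , [] , mp (ax a6) (cs A)))

in-totalCS : ∀ {n} {p : Fin n → JVar} {Δ Y Φ} CS → Justified p Δ Y Φ →
             Σ JTerm λ t → Σ ConstSpec λ CS' → TermOver p t × (CS ⊆CS CS') × Deriv CS' Δ (t ∶[ Y ] Φ)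
in-totalCS CS (t , t/p , d) = t , totalCS , t/p , axiomatic CS , d

mainTheorem3 :
    -- (1)
    (∀ (CS : ConstSpec) (n : ℕ) (p : Fin n → JVar) (Xs : Fin n → FinSet)
       (Φs : Fin n → Formula) (X : FinSet) (Φ : Formula) →
       IsUnion Xs X →
       Deriv CS (tabulate (λ i → jv (p i) ∶[ Xs i ] Φs i)) Φ →
       Σ JTerm λ t → Σ ConstSpec λ CS' → TermOver p t × (CS ⊆CS CS') ×
         Deriv CS' (tabulate (λ i → jv (p i) ∶[ Xs i ] Φs i)) (t ∶[ X ] Φ))
    ×
    -- (2)
    (∀ (CS : ConstSpec) (n : ℕ) (Φs : Fin n → Formula) (Φ : Formula) →
       Deriv CS (tabulate Φs) Φ →
       ∀ (p : Fin n → JVar) (Xs : Fin n → FinSet) (X : FinSet) → IsUnion Xs X →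
       Σ JTerm λ t → Σ ConstSpec λ CS' → TermOver p t × (CS ⊆CS CS') ×
         Deriv CS' (tabulate (λ i → jv (p i) ∶[ Xs i ] Φs i)) (t ∶[ X ] Φ))
    ×
    -- (3)
    (∀ (CS : ConstSpec) (Φ : Formula) →
       Deriv CS [] Φ →
       Σ JTerm λ t → Σ ConstSpec λ CS' → (CS ⊆CS CS') × Deriv CS' [] (t ∶[ ∅ ] Φ))
mainTheorem3 =
    (λ CS n p Xs Φs X Φ X≡⋃Xs d →
       in-totalCS CS (lift (λ i Xsi⊆Y → !-hyp-justified i (∈-tabulate⁺ i) (λ z∈ → Xsi⊆Y z∈ z∈))
                           d (λ i z∈ _ → IsUnion⇒⊆ {Xs = Xs} {X} X≡⋃Xs i z∈)))
  , (λ CS n Φs Φ d p Xs X X≡⋃Xs →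
       in-totalCS CS (lift {Ψ = Φs} {Xs} (λ i → hyp-justified {X = Xs i} i (∈-tabulate⁺ i))
                           d (λ i z∈ _ → IsUnion⇒⊆ {Xs = Xs} {X} X≡⋃Xs i z∈)))
  , (λ CS Φ d →
       let t , _ , D = lift {p = λ ()} {Ψ = λ ()} {Xs = λ ()} (λ ()) d (λ ())
       in  t , totalCS , axiomatic CS , D)
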